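{- Let $k+1$ and $p>k(k+1)$ be odd primes, and let $N_k$ be the set of vectors $\mathbf{v}\in(\mathbb{Z}/(k+1)\mathbb{Z})^k$ with $\mathbf{v}\ne\mathbf{0}$ and having at least one zero coordinate. For every $\mathbf{v}\in N_k$ there exist $s\in\mathbb{Z}/(k+1)\mathbb{Z}$ and $r\in\mathbb{Z}$ such that, modulo $k+1$, \[s\mathbf{v}+\mathbf{r}_k\!\left(\tfrac{r}{p}\right)\in\{1,\ldots,k-1\}^k.\]
   Context: For real $t$, $\{t\}$ denotes the fractional part of $t$, and \[\mathbf{r}_k(t):=\big(\lfloor (k+1)\{t\}\rfloor,\ \lfloor (k+1)\{2t\}\rfloor,\ \ldots,\ \lfloor (k+1)\{kt\}\rfloor\big)\in\mathbb{Z}^k,\] considered modulo $k+1$ in the statement. -}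

module Defs where

open import Data.Nat as ℕ using (ℕ; suc; NonZero)
open import Data.Integer as ℤ using (ℤ; +_; _%ℕ_)
open import Data.Rational as ℚ using (ℚ; floor)
open import Data.Fin using (Fin; toℕ)

frac : ℚ → ℚ
frac t = t ℚ.- ((floor t) ℚ./ 1)

-- i-th coordinate (i = 1..k) of r_k(t) for t = r/p :  ⌊(k+1){ i r / p }⌋
-- (coordinates indexed by j : Fin k, standing for i = j+1)
rk : (k p : ℕ) .{{_ : NonZero p}} → ℤ → Fin k → ℤ
rk k p r j = floor ((+ suc k ℚ./ 1) ℚ.* frac ((+ suc (toℕ j) ℤ.* r) ℚ./ p))

IsZeroVec : {k : ℕ} → (Fin k → Fin (suc k)) → Set
IsZeroVec {k} v = ∀ j → toℕ (v j) ≡ 0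
  where open import Relation.Binary.PropositionalEquality using (_≡_)

coord : (k p : ℕ) .{{_ : NonZero p}} → Fin (suc k) → (Fin k → Fin (suc k)) → ℤ → Fin k → ℕ
coord k p s v r j = ((+ toℕ s) ℤ.* (+ toℕ (v j)) ℤ.+ rk k p r j) %ℕ suc k

{-# OPTIONS --safe #-}
-- Write K = k + 1 and V for v read in ℕ. If R·K = α·p + e with e ≤ k, then (j + 1)·e < p and
-- r_k(R/p) is the progression α·(1, …, k) mod K, so it suffices to find s and α with
-- s·V_l + (l + 1)·α ∉ {0, −1} mod K for every l.
--
-- Let y(σ) = V + σ·(1, …, k). If some y(σ) has no zero entry but two equal entries, some
-- μ ∈ {1, …, k} sends no entry of y(σ) to −1: otherwise μ ↦ (an entry it sends to −1) would
-- be a bijection of {1, …, k}, and the two equal entries would have the same preimage. Then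
-- s = μ and α = μσ work.
--
-- Such a σ exists. Otherwise, for every σ, ∏ y(σ) is ≡ 0 if y(σ) has a zero entry and
-- ≡ ∏ (1, …, k) if not, its entries then being the k units in some order. Now
-- ∏_l (V_l + (l + 1)x) − ∏_l (l + 1)x has degree < K − 1, so its sum over x ∈ ℤ/K vanishes.
-- Comparing with V = 0 shows that the number of zero-free y(σ) is ≡ k mod K. But σ = 0 and
-- the root of V_j + (j + 1)σ for a nonzero V_j are two distinct σ with a zero entry, so that
-- number is less than k.
module Submission where

open import Defs
open import Data.Nat.Base
  using (ℕ; zero; suc; pred; _+_; _*_; _∸_; _<_; _≤_; z≤n; s≤s; s≤s⁻¹; NonZero; _%_; _/_;
         >-nonZero; ≢-nonZero⁻¹; nonTrivial⇒n>1)
open import Data.Nat.Properties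
  using (_≟_; +-*-semiring; *-1-commutativeMonoid; ≤-refl; ≤-trans; ≤-total; <-trans; ≤-<-trans;
         <⇒≤; <⇒≢; <⇒≱; ≤∧≢⇒<; n<1+n; n≤1+n; n≢0⇒n>0; +-comm; +-suc; +-identityʳ; +-cancelʳ-≡;
         +-mono-≤; +-mono-≤-<; *-comm; *-identityˡ; *-identityʳ; *-zeroʳ; *-distribˡ-+; *-distribʳ-+;
         *-distribʳ-∸; *-mono-≤; *-monoˡ-≤; *-monoʳ-≤; m+n≤o⇒m≤o; m+n≤o⇒m≤o∸n; m∸n≤m; m+n∸m≡n;
         m+[n∸m]≡n; +-∸-assoc; [m+n]∸[m+o]≡n∸o)
open import Data.Nat.DivMod
  using (m≡m%n+[m/n]*n; m%n%n≡m%n; [m+kn]%n≡m%n; %-distribˡ-+; %-distribˡ-*; %-remove-+ʳ;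
         m%n<n; m<n⇒m%n≡m; n%n≡0; +-distrib-/-∣ʳ; m<n⇒m/n≡0; m*n/n≡m; m*n/o*n≡m/o)
open import Data.Nat.Divisibility using (_∣_; divides; ∣m⇒∣m*n; ∣n⇒∣m*n; n∣m⇒m%n≡0; ∣⇒≤; n∣m*n)
open import Data.Nat.Primality using (Prime; euclidsLemma; prime⇒nonTrivial)
open import Data.Nat.Combinatorics using (_C_; nC1≡n; nCk+nC[k+1]≡[n+1]C[k+1])
open import Data.Nat.GCD using (gcd)
open import Data.Nat.Tactic.RingSolver using (solve-∀)
open import Data.Integer.Base as ℤ using (ℤ; -[1+_])
import Data.Integer.Properties as ℤ
open import Data.Integer.DivMod using (div-pos-is-/ℕ)
import Data.Integer.Tactic.RingSolver as ℤ-Solver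
open import Data.Rational.Base as ℚ using (ℚ; mkℚ; floor; ↥_; ↧_)
import Data.Rational.Properties as ℚ
open import Data.Rational.Unnormalised.Base as ℚᵘ using (mkℚᵘ; *≡*; _≃_)
import Data.Rational.Unnormalised.Properties as ℚᵘ
open import Data.Fin.Base using (Fin; zero; suc; toℕ; fromℕ; fromℕ<; inject₁; punchOut)
open import Data.Fin.Properties
  using (toℕ-fromℕ; toℕ-fromℕ<; toℕ-inject₁; toℕ-injective; toℕ<n; punchOut-injective;
         punchIn-punchOut; injective⇒≤; any?; ¬∀⟶∃¬)
  renaming (_≟_ to _≟ᶠ_; suc-injective to suc-injectiveᶠ)
open import Data.Product using (Σ; ∃; ∃₂; _×_; _,_; proj₁; proj₂)
open import Data.Sum using (inj₁; inj₂)
open import Function.Base using (_∘_)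
open import Function.Bundles using (_↔_; mk⤖)
open import Function.Definitions using (Injective; StrictlySurjective)
open import Function.Consequences.Propositional using (strictlySurjective⇒surjective)
open import Function.Properties.Bijection using (⤖⇒↔)
open import Level using (0ℓ)
open import Relation.Binary.Bundles using (Setoid)
import Relation.Binary.Reasoning.Setoid
open import Relation.Binary.PropositionalEquality
open import Relation.Nullary using (¬_; Dec; yes; no; contradiction; ¬?)
open import Relation.Nullary.Decidable using (_×-dec_; map′)
open import Algebra.Properties.Semiring.Sum +-*-semiring
  using (sum; sum-syntax; ∑-distrib-+; *-distribˡ-sum; *-distribʳ-sum; sum-cong-≗; sum-init-last)
open import Algebra.Properties.CommutativeMonoid.Sum *-1-commutativeMonoid
  using () renaming (sum to ∏; sum-cong-≗ to ∏-cong-≗; ∑-permute to ∏-permute)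

infix 4 _≡_mod_

record _≡_mod_ (m n d : ℕ) .{{_ : NonZero d}} : Set where
  constructor mk≡
  field %-≡ : m % d ≡ n % d

open _≡_mod_

module _ {d : ℕ} .{{_ : NonZero d}} where

  ≡-mod-refl : ∀ {a} → a ≡ a mod d
  ≡-mod-refl = mk≡ refl

  ≡-mod-sym : ∀ {a b} → a ≡ b mod d → b ≡ a mod d
  ≡-mod-sym (mk≡ a≡b) = mk≡ (sym a≡b)

  ≡-mod-trans : ∀ {a b c} → a ≡ b mod d → b ≡ c mod d → a ≡ c mod d
  ≡-mod-trans (mk≡ a≡b) (mk≡ b≡c) = mk≡ (trans a≡b b≡c)

  ≡⇒≡-mod : ∀ {a b} → a ≡ b → a ≡ b mod d
  ≡⇒≡-mod refl = ≡-mod-refl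

  ≡-mod-setoid : Setoid 0ℓ 0ℓ
  ≡-mod-setoid = record
    { Carrier       = ℕ
    ; _≈_           = λ a b → a ≡ b mod d
    ; isEquivalence = record { refl = ≡-mod-refl ; sym = ≡-mod-sym ; trans = ≡-mod-trans }
    }

  module ≡-mod-Reasoning = Relation.Binary.Reasoning.Setoid ≡-mod-setoid

  ≡-mod? : ∀ a b → Dec (a ≡ b mod d)
  ≡-mod? a b = map′ mk≡ %-≡ (a % d ≟ b % d)

  %-≡-mod : ∀ m → m % d ≡ m mod d
  %-≡-mod m = mk≡ (m%n%n≡m%n m d)

  +-multiple-mod : ∀ m q → m + q * d ≡ m mod d
  +-multiple-mod m q = mk≡ ([m+kn]%n≡m%n m q d)

  +-cong-mod : ∀ {a b c e} → a ≡ b mod d → c ≡ e mod d → a + c ≡ b + e mod d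
  +-cong-mod {a} {b} {c} {e} (mk≡ a≡b) (mk≡ c≡e) = mk≡ (begin
    (a + c) % d            ≡⟨ %-distribˡ-+ a c d ⟩
    (a % d + c % d) % d    ≡⟨ cong₂ (λ x y → (x + y) % d) a≡b c≡e ⟩
    (b % d + e % d) % d    ≡⟨ %-distribˡ-+ b e d ⟨
    (b + e) % d            ∎)
    where open ≡-Reasoning

  *-cong-mod : ∀ {a b c e} → a ≡ b mod d → c ≡ e mod d → a * c ≡ b * e mod d
  *-cong-mod {a} {b} {c} {e} (mk≡ a≡b) (mk≡ c≡e) = mk≡ (begin
    (a * c) % d            ≡⟨ %-distribˡ-* a c d ⟩
    (a % d * (c % d)) % d  ≡⟨ cong₂ (λ x y → (x * y) % d) a≡b c≡e ⟩
    (b % d * (e % d)) % d  ≡⟨ %-distribˡ-* b e d ⟨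
    (b * e) % d            ∎)
    where open ≡-Reasoning

  *-congˡ-mod : ∀ c {a b} → a ≡ b mod d → c * a ≡ c * b mod d
  *-congˡ-mod c = *-cong-mod {c} {c} ≡-mod-refl

  ≡-mod⇒≡ : ∀ {a b} → a < d → b < d → a ≡ b mod d → a ≡ b
  ≡-mod⇒≡ a<d b<d (mk≡ a≡b) = trans (sym (m<n⇒m%n≡m a<d)) (trans a≡b (m<n⇒m%n≡m b<d))

  ≡-mod⇒∣∸ : ∀ {a b} → b ≤ a → a ≡ b mod d → d ∣ a ∸ b
  ≡-mod⇒∣∸ {a} {b} b≤a (mk≡ a≡b) = divides (a / d ∸ b / d) (begin
    a ∸ b                                      ≡⟨ cong₂ _∸_ (m≡m%n+[m/n]*n a d) (m≡m%n+[m/n]*n b d) ⟩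
    (a % d + a / d * d) ∸ (b % d + b / d * d)  ≡⟨ cong (λ r → (r + a / d * d) ∸ (b % d + b / d * d)) a≡b ⟩
    (b % d + a / d * d) ∸ (b % d + b / d * d)  ≡⟨ [m+n]∸[m+o]≡n∸o (b % d) (a / d * d) (b / d * d) ⟩
    a / d * d ∸ b / d * d                      ≡⟨ *-distribʳ-∸ d (a / d) (b / d) ⟨
    (a / d ∸ b / d) * d                        ∎)
    where open ≡-Reasoning

  ∣∸⇒≡-mod : ∀ {a b} → b ≤ a → d ∣ a ∸ b → a ≡ b mod d
  ∣∸⇒≡-mod {a} {b} b≤a d∣a∸b = mk≡ (trans (cong (_% d) (sym (m+[n∸m]≡n b≤a))) (%-remove-+ʳ b d∣a∸b))

  ∣⇒≡0-mod : ∀ {a} → d ∣ a → a ≡ 0 mod d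
  ∣⇒≡0-mod {a} d∣a = mk≡ (trans (n∣m⇒m%n≡0 a d d∣a) (sym (n∣m⇒m%n≡0 0 d (divides 0 refl))))

  ≡0-mod⇒∣ : ∀ {a} → a ≡ 0 mod d → d ∣ a
  ≡0-mod⇒∣ = ≡-mod⇒∣∸ z≤n

  <-nonzero-mod : ∀ {a} → 0 < a → a < d → ¬ a ≡ 0 mod d
  <-nonzero-mod 0<a a<d a≡0 = <⇒≱ a<d (∣⇒≤ {{>-nonZero 0<a}} (≡0-mod⇒∣ a≡0))

  ∑-cong-mod : ∀ {n} {f g : Fin n → ℕ} → (∀ i → f i ≡ g i mod d) → sum f ≡ sum g mod d
  ∑-cong-mod {zero}  _   = ≡-mod-refl
  ∑-cong-mod {suc n} f≡g = +-cong-mod (f≡g zero) (∑-cong-mod (f≡g ∘ suc))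

  ∏-cong-mod : ∀ {n} {f g : Fin n → ℕ} → (∀ i → f i ≡ g i mod d) → ∏ f ≡ ∏ g mod d
  ∏-cong-mod {zero}  _   = ≡-mod-refl
  ∏-cong-mod {suc n} f≡g = *-cong-mod (f≡g zero) (∏-cong-mod (f≡g ∘ suc))

∣-∏ : ∀ {d n} (f : Fin n → ℕ) (i : Fin n) → d ∣ f i → d ∣ ∏ f
∣-∏ f zero    d∣fi = ∣m⇒∣m*n (∏ (f ∘ suc)) d∣fi
∣-∏ f (suc i) d∣fi = ∣n⇒∣m*n (f zero) (∣-∏ (f ∘ suc) i d∣fi)

injective⇒surjective : ∀ {n} {f : Fin n → Fin n} → Injective _≡_ _≡_ f → StrictlySurjective _≡_ f
injective⇒surjective {suc n} {f} f-injective y with any? (λ x → f x ≟ᶠ y)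
... | yes hit  = hit
... | no  miss = contradiction (injective⇒≤ g-injective) (<⇒≱ (n<1+n n))
  where
  g : Fin (suc n) → Fin n
  g x = punchOut {i = y} (λ y≡fx → miss (x , sym y≡fx))

  g-injective : Injective _≡_ _≡_ g
  g-injective {x} {x′} = f-injective ∘ punchOut-injective {i = y} {j = f x} {k = f x′} _ _

∏-injective-reindex : ∀ {n} (g : Fin n → ℕ) {f : Fin n → Fin n} → Injective _≡_ _≡_ f → ∏ (g ∘ f) ≡ ∏ g
∏-injective-reindex {n} g {f} f-injective = sym (∏-permute g π)
  where
  π : Fin n ↔ Fin n
  π = ⤖⇒↔ (mk⤖ (f-injective , strictlySurjective⇒surjective (injective⇒surjective f-injective)))

∑-≤1 : ∀ {n} (f : Fin n → ℕ) → (∀ i → f i ≤ 1) → sum f ≤ n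
∑-≤1 {zero}  f f≤1 = z≤n
∑-≤1 {suc n} f f≤1 = +-mono-≤ (f≤1 zero) (∑-≤1 (f ∘ suc) (f≤1 ∘ suc))

∑-≤1-< : ∀ {n} (f : Fin n → ℕ) → (∀ i → f i ≤ 1) → ∀ j → f j ≡ 0 → sum f < n
∑-≤1-< f f≤1 zero    fj≡0 rewrite fj≡0 = s≤s (∑-≤1 (f ∘ suc) (f≤1 ∘ suc))
∑-≤1-< f f≤1 (suc j) fj≡0 = +-mono-≤-< (f≤1 zero) (∑-≤1-< (f ∘ suc) (f≤1 ∘ suc) j fj≡0)

∑-ones : ∀ {n} (f : Fin n → ℕ) → (∀ i → f i ≡ 1) → sum f ≡ n
∑-ones {zero}  f f≡1 = refl
∑-ones {suc n} f f≡1 = cong₂ _+_ (f≡1 zero) (∑-ones (f ∘ suc) (f≡1 ∘ suc))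

n*nCk≡[k+1]*nC[k+1]+k*nCk : ∀ n k → n * (n C k) ≡ suc k * (n C suc k) + k * (n C k)
n*nCk≡[k+1]*nC[k+1]+k*nCk zero    zero    = refl
n*nCk≡[k+1]*nC[k+1]+k*nCk zero    (suc k) = sym (cong₂ _+_ (*-zeroʳ (2 + k)) (*-zeroʳ (suc k)))
n*nCk≡[k+1]*nC[k+1]+k*nCk (suc n) zero    = begin
  suc n * 1            ≡⟨ *-identityʳ (suc n) ⟩
  suc n                ≡⟨ nC1≡n (suc n) ⟨
  suc n C 1            ≡⟨ trans (+-identityʳ _) (*-identityˡ _) ⟨
  1 * (suc n C 1) + 0  ∎
  where open ≡-Reasoning
n*nCk≡[k+1]*nC[k+1]+k*nCk (suc n) (suc k) = begin
  suc n * (suc n C suc k)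
    ≡⟨ cong (suc n *_) (pascal k) ⟩
  suc n * (a + b)
    ≡⟨ expand n a b ⟩
  a + b + n * a + n * b
    ≡⟨ cong₂ (λ x y → a + b + x + y) (n*nCk≡[k+1]*nC[k+1]+k*nCk n k) (n*nCk≡[k+1]*nC[k+1]+k*nCk n (suc k)) ⟩
  a + b + (suc k * b + k * a) + ((2 + k) * c + suc k * b)
    ≡⟨ collect k a b c ⟩
  (2 + k) * (b + c) + suc k * (a + b)
    ≡⟨ cong₂ (λ x y → (2 + k) * x + suc k * y) (pascal (suc k)) (pascal k) ⟨
  (2 + k) * (suc n C (2 + k)) + suc k * (suc n C suc k)
    ∎
  where
  open ≡-Reasoning
  a b c : ℕ
  a = n C k
  b = n C suc k
  c = n C (2 + k)
  pascal : ∀ j → suc n C suc j ≡ n C j + n C suc j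
  pascal j = sym (nCk+nC[k+1]≡[n+1]C[k+1] n j)
  expand : ∀ n a b → suc n * (a + b) ≡ a + b + n * a + n * b
  expand = solve-∀
  collect : ∀ k a b c → a + b + (suc k * b + k * a) + ((2 + k) * c + suc k * b) ≡
                        (2 + k) * (b + c) + suc k * (a + b)
  collect = solve-∀

[k+1]*[n+1]C[k+1]≡[n+1]*nCk : ∀ n k → suc k * (suc n C suc k) ≡ suc n * (n C k)
[k+1]*[n+1]C[k+1]≡[n+1]*nCk n k = +-cancelʳ-≡ (k * a) _ _ (begin
  suc k * (suc n C suc k) + k * a   ≡⟨ cong (λ x → suc k * x + k * a) (nCk+nC[k+1]≡[n+1]C[k+1] n k) ⟨
  suc k * (a + b) + k * a           ≡⟨ split k a b ⟩
  suc k * a + (suc k * b + k * a)   ≡⟨ cong (suc k * a +_) (n*nCk≡[k+1]*nC[k+1]+k*nCk n k) ⟨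
  suc k * a + n * a                 ≡⟨ merge k n a ⟩
  suc n * a + k * a                 ∎)
  where
  open ≡-Reasoning
  a b : ℕ
  a = n C k
  b = n C suc k
  split : ∀ k a b → suc k * (a + b) + k * a ≡ suc k * a + (suc k * b + k * a)
  split = solve-∀
  merge : ∀ k n a → suc k * a + n * a ≡ suc n * a + k * a
  merge = solve-∀

p∣pC[k+1] : ∀ {n k} → Prime (suc n) → k < n → suc n ∣ suc n C suc k
p∣pC[k+1] {n} {k} prime[n+1] k<n
  with euclidsLemma (suc k) (suc n C suc k) prime[n+1]
         (divides (n C k) (trans ([k+1]*[n+1]C[k+1]≡[n+1]*nCk n k) (*-comm (suc n) (n C k))))
... | inj₁ p∣k+1 = contradiction (∣⇒≤ p∣k+1) (<⇒≱ (s≤s k<n))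
... | inj₂ p∣C   = p∣C

∑[x<n]xCk≡nC[k+1] : ∀ n k → ∑[ x < n ] (toℕ x C k) ≡ n C suc k
∑[x<n]xCk≡nC[k+1] zero    k = refl
∑[x<n]xCk≡nC[k+1] (suc n) k = begin
  ∑[ x < suc n ] (toℕ x C k)
    ≡⟨ sum-init-last {n} (λ x → toℕ x C k) ⟩
  ∑[ x < n ] (toℕ (inject₁ x) C k) + toℕ (fromℕ n) C k
    ≡⟨ cong₂ _+_ (sum-cong-≗ {n} (λ x → cong (_C k) (toℕ-inject₁ x))) (cong (_C k) (toℕ-fromℕ n)) ⟩
  ∑[ x < n ] (toℕ x C k) + n C k
    ≡⟨ cong (_+ n C k) (∑[x<n]xCk≡nC[k+1] n k) ⟩
  n C suc k + n C k
    ≡⟨ +-comm (n C suc k) (n C k) ⟩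
  n C k + n C suc k
    ≡⟨ nCk+nC[k+1]≡[n+1]C[k+1] n k ⟩
  suc n C suc k
    ∎
  where open ≡-Reasoning

module _ {k : ℕ} (prime : Prime (suc k)) where

  private
    K : ℕ
    K = suc k

  1<K : 1 < K
  1<K = nonTrivial⇒n>1 K {{prime⇒nonTrivial prime}}

  moment : ℕ → (ℕ → ℕ) → ℕ
  moment i f = ∑[ x < K ] ((toℕ x C i) * f (toℕ x))

  moment-cong : ∀ i {f g : ℕ → ℕ} → (∀ x → f x ≡ g x) → moment i f ≡ moment i g
  moment-cong i f≗g = sum-cong-≗ {K} (λ x → cong ((toℕ x C i) *_) (f≗g (toℕ x)))

  moment-+ : ∀ i f g → moment i (λ x → f x + g x) ≡ moment i f + moment i g
  moment-+ i f g = trans (sum-cong-≗ {K} (λ x → *-distribˡ-+ (toℕ x C i) (f (toℕ x)) (g (toℕ x))))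
                         (∑-distrib-+ {K} (λ x → (toℕ x C i) * f (toℕ x)) (λ x → (toℕ x C i) * g (toℕ x)))

  moment-* : ∀ i c f → moment i (λ x → c * f x) ≡ c * moment i f
  moment-* i c f = trans (sum-cong-≗ {K} (λ x → swap (toℕ x C i) c (f (toℕ x))))
                         (sym (*-distribˡ-sum {K} c (λ x → (toℕ x C i) * f (toℕ x))))
    where
    swap : ∀ a b c → a * (b * c) ≡ b * (a * c)
    swap = solve-∀

  moment-const : ∀ {i} c → i < k → moment i (λ _ → c) ≡ 0 mod K
  moment-const {i} c i<k = mk≡ (begin
    moment i (λ _ → c) % K            ≡⟨ cong (_% K) (*-distribʳ-sum {K} c (λ x → toℕ x C i)) ⟨
    (∑[ x < K ] (toℕ x C i) * c) % K  ≡⟨ cong (λ s → (s * c) % K) (∑[x<n]xCk≡nC[k+1] K i) ⟩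
    ((K C suc i) * c) % K             ≡⟨ n∣m⇒m%n≡0 _ K (∣m⇒∣m*n c (p∣pC[k+1] prime i<k)) ⟩
    0                                 ∎)
    where open ≡-Reasoning

  moment-linear : ∀ i u l f → moment i (λ x → (u + l * x) * f x) ≡
                  u * moment i f + l * (suc i * moment (suc i) f + i * moment i f)
  moment-linear i u l f = begin
    moment i (λ x → (u + l * x) * f x)
      ≡⟨ sum-cong-≗ {K} (pointwise ∘ toℕ) ⟩
    ∑[ x < K ] (u * A x + l * (suc i * B x + i * A x))
      ≡⟨ ∑-distrib-+ {K} (λ x → u * A x) (λ x → l * (suc i * B x + i * A x)) ⟩
    ∑[ x < K ] (u * A x) + ∑[ x < K ] (l * (suc i * B x + i * A x))
      ≡⟨ cong₂ _+_ (*-distribˡ-sum {K} u A) (*-distribˡ-sum {K} l (λ x → suc i * B x + i * A x)) ⟨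
    u * sum A + l * ∑[ x < K ] (suc i * B x + i * A x)
      ≡⟨ cong (λ s → u * sum A + l * s) (∑-distrib-+ {K} (λ x → suc i * B x) (λ x → i * A x)) ⟩
    u * sum A + l * (∑[ x < K ] (suc i * B x) + ∑[ x < K ] (i * A x))
      ≡⟨ cong (λ s → u * sum A + l * s) (cong₂ _+_ (*-distribˡ-sum {K} (suc i) B) (*-distribˡ-sum {K} i A)) ⟨
    u * sum A + l * (suc i * sum B + i * sum A)
      ∎
    where
    open ≡-Reasoning
    A B : Fin K → ℕ
    A x = (toℕ x C i) * f (toℕ x)
    B x = (toℕ x C suc i) * f (toℕ x)
    pull : ∀ c u l x y → c * ((u + l * x) * y) ≡ u * (c * y) + l * ((x * c) * y)
    pull = solve-∀
    push : ∀ u l s i b c y → u * (c * y) + l * ((s * b + i * c) * y) ≡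
                             u * (c * y) + l * (s * (b * y) + i * (c * y))
    push = solve-∀
    pointwise : ∀ x → (x C i) * ((u + l * x) * f x) ≡
                      u * ((x C i) * f x) + l * (suc i * ((x C suc i) * f x) + i * ((x C i) * f x))
    pointwise x = begin
      (x C i) * ((u + l * x) * f x)
        ≡⟨ pull (x C i) u l x (f x) ⟩
      u * ((x C i) * f x) + l * ((x * (x C i)) * f x)
        ≡⟨ cong (λ y → u * ((x C i) * f x) + l * (y * f x)) (n*nCk≡[k+1]*nC[k+1]+k*nCk x i) ⟩
      u * ((x C i) * f x) + l * ((suc i * (x C suc i) + i * (x C i)) * f x)
        ≡⟨ push u l (suc i) i (x C suc i) (x C i) (f x) ⟩
      u * ((x C i) * f x) + l * (suc i * ((x C suc i) * f x) + i * ((x C i) * f x))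
        ∎

  -- f ≈[ d ] g stands for "f − g is a polynomial of degree ≤ d", through its consequence that
  -- the binomial moments ∑ₓ C(x, i)·f(x) over x ∈ ℤ/K agree with those of g for i + d < k; the
  -- moment i = 0 is the plain sum. Constants have vanishing moments since ∑ₓ C(x, i) = C(K, i + 1),
  -- and x·C(x, i) = (i + 1)·C(x, i + 1) + i·C(x, i) lets a linear factor raise the degree by one.
  infix 4 _≈[_]_

  record _≈[_]_ (f : ℕ → ℕ) (d : ℕ) (g : ℕ → ℕ) : Set where
    constructor mk≈
    field moments : ∀ i → i + d < k → moment i f ≡ moment i g mod K

  open _≈[_]_

  ≗⇒≈ : ∀ {d f g} → (∀ x → f x ≡ g x) → f ≈[ d ] g
  ≗⇒≈ f≗g = mk≈ λ i _ → ≡⇒≡-mod (moment-cong i f≗g)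

  ≈-trans : ∀ {d f g h} → f ≈[ d ] g → g ≈[ d ] h → f ≈[ d ] h
  ≈-trans f≈g g≈h = mk≈ λ i i+d<k → ≡-mod-trans (moments f≈g i i+d<k) (moments g≈h i i+d<k)

  const≈0 : ∀ {d} c → (λ _ → c) ≈[ d ] (λ _ → 0)
  const≈0 c = mk≈ λ i i+d<k → let i<k = m+n≤o⇒m≤o (suc i) i+d<k in
    ≡-mod-trans (moment-const c i<k) (≡-mod-sym (moment-const 0 i<k))

  +-cong-≈ : ∀ {d f f′ g g′} → f ≈[ d ] f′ → g ≈[ d ] g′ → (λ x → f x + g x) ≈[ d ] (λ x → f′ x + g′ x)
  +-cong-≈ {f = f} {f′} {g} {g′} f≈f′ g≈g′ = mk≈ λ i i+d<k → begin
    moment i (λ x → f x + g x)    ≡⟨ moment-+ i f g ⟩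
    moment i f + moment i g       ≈⟨ +-cong-mod (moments f≈f′ i i+d<k) (moments g≈g′ i i+d<k) ⟩
    moment i f′ + moment i g′     ≡⟨ moment-+ i f′ g′ ⟨
    moment i (λ x → f′ x + g′ x)  ∎
    where open ≡-mod-Reasoning

  *-congˡ-≈ : ∀ {d f g} c → f ≈[ d ] g → (λ x → c * f x) ≈[ d ] (λ x → c * g x)
  *-congˡ-≈ {f = f} {g} c f≈g = mk≈ λ i i+d<k → begin
    moment i (λ x → c * f x)  ≡⟨ moment-* i c f ⟩
    c * moment i f            ≈⟨ *-congˡ-mod c (moments f≈g i i+d<k) ⟩
    c * moment i g            ≡⟨ moment-* i c g ⟨
    moment i (λ x → c * g x)  ∎
    where open ≡-mod-Reasoning

  linear-*-≈ : ∀ {d f g} u l → f ≈[ d ] g → (λ x → (u + l * x) * f x) ≈[ suc d ] (λ x → (u + l * x) * g x)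
  linear-*-≈ {d} {f} {g} u l f≈g = mk≈ λ i i+d+1<k →
    let i+1+d<k = subst (_< k) (+-suc i d) i+d+1<k
        mᵢ      = moments f≈g i (<-trans (n<1+n (i + d)) i+1+d<k)
        mᵢ₊₁    = moments f≈g (suc i) i+1+d<k
    in begin
      moment i (λ x → (u + l * x) * f x)
        ≡⟨ moment-linear i u l f ⟩
      u * moment i f + l * (suc i * moment (suc i) f + i * moment i f)
        ≈⟨ +-cong-mod (*-congˡ-mod u mᵢ) (*-congˡ-mod l (+-cong-mod (*-congˡ-mod (suc i) mᵢ₊₁) (*-congˡ-mod i mᵢ))) ⟩
      u * moment i g + l * (suc i * moment (suc i) g + i * moment i g)
        ≡⟨ moment-linear i u l g ⟨
      moment i (λ x → (u + l * x) * g x)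
        ∎
    where open ≡-mod-Reasoning

  ∏-linear-≈0 : ∀ {n} (w : Fin n → ℕ) → (λ x → ∏ λ l → w l * x) ≈[ n ] (λ _ → 0)
  ∏-linear-≈0 {zero}  w = const≈0 1
  ∏-linear-≈0 {suc n} w = ≈-trans (linear-*-≈ 0 (w zero) (∏-linear-≈0 (w ∘ suc)))
                                  (≗⇒≈ (λ x → *-zeroʳ (w zero * x)))

  ∏-affine-≈ : ∀ {n} (V w : Fin n → ℕ) → (λ x → ∏ λ l → V l + w l * x) ≈[ pred n ] (λ x → ∏ λ l → w l * x)
  ∏-affine-≈ {zero}        V w = ≗⇒≈ (λ _ → refl)
  ∏-affine-≈ {suc zero}    V w =
    ≈-trans (≗⇒≈ (λ x → *-identityʳ (V zero + w zero * x)))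
      (≈-trans (+-cong-≈ (const≈0 (V zero)) (≗⇒≈ (λ _ → refl)))
        (≗⇒≈ (λ x → sym (*-identityʳ (w zero * x)))))
  -- (V₀ + w₀x)·P_V ≈ (V₀ + w₀x)·P₀ = V₀·P₀ + w₀x·P₀ ≈ w₀x·P₀, since P₀ has degree n + 1.
  ∏-affine-≈ {suc (suc n)} V w =
    ≈-trans (linear-*-≈ (V zero) (w zero) (∏-affine-≈ (V ∘ suc) (w ∘ suc)))
      (≈-trans (≗⇒≈ (λ x → *-distribʳ-+ (P x) (V zero) (w zero * x)))
        (+-cong-≈ (≈-trans (*-congˡ-≈ (V zero) (∏-linear-≈0 (w ∘ suc))) (≗⇒≈ (λ _ → *-zeroʳ (V zero))))
                  (≗⇒≈ (λ _ → refl))))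
    where
    P : ℕ → ℕ
    P x = ∏ λ l → w (suc l) * x

  ∑-∏-affine : ∀ {n} (V w : Fin n → ℕ) → n ≤ k →
               ∑[ x < K ] (∏ λ l → V l + w l * toℕ x) ≡ ∑[ x < K ] (∏ λ l → w l * toℕ x) mod K
  ∑-∏-affine {zero}  V w _     = ≡-mod-refl
  ∑-∏-affine {suc n} V w n+1≤k = begin
    ∑[ x < K ] (∏ λ l → V l + w l * toℕ x)  ≡⟨ plain-sum (λ x → ∏ λ l → V l + w l * x) ⟨
    moment 0 (λ x → ∏ λ l → V l + w l * x)  ≈⟨ moments (∏-affine-≈ V w) 0 n+1≤k ⟩
    moment 0 (λ x → ∏ λ l → w l * x)        ≡⟨ plain-sum (λ x → ∏ λ l → w l * x) ⟩
    ∑[ x < K ] (∏ λ l → w l * toℕ x)        ∎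
    where
    open ≡-mod-Reasoning
    plain-sum : ∀ f → moment 0 f ≡ ∑[ x < K ] f (toℕ x)
    plain-sum f = sum-cong-≗ {K} (λ x → *-identityˡ (f (toℕ x)))

  *-nonzero-mod : ∀ {a b} → ¬ a ≡ 0 mod K → ¬ b ≡ 0 mod K → ¬ a * b ≡ 0 mod K
  *-nonzero-mod {a} {b} a≢0 b≢0 ab≡0 with euclidsLemma a b prime (≡0-mod⇒∣ ab≡0)
  ... | inj₁ K∣a = a≢0 (∣⇒≡0-mod K∣a)
  ... | inj₂ K∣b = b≢0 (∣⇒≡0-mod K∣b)

  ∏-nonzero-mod : ∀ {n} (f : Fin n → ℕ) → (∀ i → ¬ f i ≡ 0 mod K) → ¬ ∏ f ≡ 0 mod K
  ∏-nonzero-mod {zero}  f _   = <-nonzero-mod (s≤s z≤n) 1<K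
  ∏-nonzero-mod {suc n} f f≢0 = *-nonzero-mod (f≢0 zero) (∏-nonzero-mod (f ∘ suc) (f≢0 ∘ suc))

  suc-nonzero-mod : ∀ {n} (i : Fin n) → n ≤ k → ¬ suc (toℕ i) ≡ 0 mod K
  suc-nonzero-mod i n≤k = <-nonzero-mod (s≤s z≤n) (s≤s (≤-trans (toℕ<n i) n≤k))

  ≤-*-cancelʳ-mod : ∀ {a b c} → ¬ c ≡ 0 mod K → b ≤ a → a * c ≡ b * c mod K → a ≡ b mod K
  ≤-*-cancelʳ-mod {a} {b} {c} c≢0 b≤a ac≡bc
    with euclidsLemma (a ∸ b) c prime
           (subst (K ∣_) (sym (*-distribʳ-∸ c a b)) (≡-mod⇒∣∸ (*-monoˡ-≤ c b≤a) ac≡bc))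
  ... | inj₁ K∣a∸b = ∣∸⇒≡-mod b≤a K∣a∸b
  ... | inj₂ K∣c   = contradiction (∣⇒≡0-mod K∣c) c≢0

  *-cancelʳ-mod : ∀ {a b c} → ¬ c ≡ 0 mod K → a * c ≡ b * c mod K → a ≡ b mod K
  *-cancelʳ-mod {a} {b} c≢0 ac≡bc with ≤-total b a
  ... | inj₁ b≤a = ≤-*-cancelʳ-mod c≢0 b≤a ac≡bc
  ... | inj₂ a≤b = ≡-mod-sym (≤-*-cancelʳ-mod c≢0 a≤b (≡-mod-sym ac≡bc))

  toℕ-injective-mod : ∀ {σ τ : Fin K} → toℕ σ ≡ toℕ τ mod K → σ ≡ τ
  toℕ-injective-mod {σ} {τ} σ≡τ = toℕ-injective (≡-mod⇒≡ (toℕ<n σ) (toℕ<n τ) σ≡τ)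

  residue : ℕ → Fin K
  residue a = fromℕ< (m%n<n a K)

  toℕ-residue : ∀ a → toℕ (residue a) ≡ a % K
  toℕ-residue a = toℕ-fromℕ< (m%n<n a K)

  residue-injective : ∀ {a b} → residue a ≡ residue b → a ≡ b mod K
  residue-injective {a} {b} eq = mk≡ (trans (sym (toℕ-residue a)) (trans (cong toℕ eq) (toℕ-residue b)))

  linear-root : ∀ a {c} → ¬ c ≡ 0 mod K → ∃ λ (σ : Fin K) → a + c * toℕ σ ≡ 0 mod K
  linear-root a {c} c≢0 =
    let σ , cσ≡−a = injective⇒surjective multiple-injective (residue (K ∸ a % K))
    in σ , (begin
      a + c * toℕ σ        ≈⟨ +-cong-mod (≡-mod-sym (%-≡-mod a)) (residue-injective cσ≡−a) ⟩
      a % K + (K ∸ a % K)  ≡⟨ m+[n∸m]≡n (<⇒≤ (m%n<n a K)) ⟩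
      K                    ≈⟨ mk≡ (n%n≡0 K) ⟩
      0                    ∎)
    where
    open ≡-mod-Reasoning
    multiple : Fin K → Fin K
    multiple τ = residue (c * toℕ τ)
    multiple-injective : Injective _≡_ _≡_ multiple
    multiple-injective {τ} {τ′} eq = toℕ-injective-mod (*-cancelʳ-mod c≢0 (begin
      toℕ τ * c   ≡⟨ *-comm (toℕ τ) c ⟩
      c * toℕ τ   ≈⟨ residue-injective eq ⟩
      c * toℕ τ′  ≡⟨ *-comm c (toℕ τ′) ⟩
      toℕ τ′ * c  ∎))

  HasZero : ∀ {n} → (Fin n → ℕ) → Set
  HasZero y = ∃ λ l → y l ≡ 0 mod K

  hasZero? : ∀ {n} (y : Fin n → ℕ) → Dec (HasZero y)
  hasZero? y = any? (λ l → ≡-mod? (y l) 0)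

  Collision : ∀ {n} → (Fin n → ℕ) → Set
  Collision y = ∃₂ λ i j → i ≢ j × y i ≡ y j mod K

  collision? : ∀ {n} (y : Fin n → ℕ) → Dec (Collision y)
  collision? y = any? (λ i → any? (λ j → ¬? (i ≟ᶠ j) ×-dec ≡-mod? (y i) (y j)))

  ∏-units-mod : (y : Fin k → ℕ) → ¬ HasZero y → ¬ Collision y → ∏ y ≡ ∏ {k} (λ i → suc (toℕ i)) mod K
  ∏-units-mod y no-zero no-collision = begin
    ∏ y                            ≈⟨ ∏-cong-mod (λ l → %-≡-mod (y l)) ⟨
    ∏ {k} (λ l → y l % K)          ≡⟨ ∏-cong-≗ {k} suc-r ⟩
    ∏ {k} (λ l → suc (toℕ (r l)))  ≡⟨ ∏-injective-reindex (λ i → suc (toℕ i)) r-injective ⟩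
    ∏ {k} (λ i → suc (toℕ i))      ∎
    where
    open ≡-mod-Reasoning
    r : Fin k → Fin k
    r l = punchOut {i = zero} {j = residue (y l)}
                   (λ 0≡r → no-zero (l , mk≡ (sym (trans (cong toℕ 0≡r) (toℕ-residue (y l))))))
    suc-r : ∀ l → y l % K ≡ suc (toℕ (r l))
    suc-r l = sym (trans (cong toℕ (punchIn-punchOut {i = zero} {j = residue (y l)} _)) (toℕ-residue (y l)))
    r-injective : Injective _≡_ _≡_ r
    r-injective {a} {b} ra≡rb with a ≟ᶠ b
    ... | yes a≡b = a≡b
    ... | no  a≢b = contradiction (a , b , a≢b , residue-injective residues≡) no-collision
      where
      residues≡ : residue (y a) ≡ residue (y b)
      residues≡ = punchOut-injective {i = zero} {j = residue (y a)} {k = residue (y b)} _ _ ra≡rb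

  zeroFree : ∀ {n} → (Fin n → ℕ) → ℕ
  zeroFree y with hasZero? y
  ... | yes _ = 0
  ... | no  _ = 1

  zeroFree-≤1 : ∀ {n} (y : Fin n → ℕ) → zeroFree y ≤ 1
  zeroFree-≤1 y with hasZero? y
  ... | yes _ = z≤n
  ... | no  _ = s≤s z≤n

  zeroFree-hasZero : ∀ {n} (y : Fin n → ℕ) → HasZero y → zeroFree y ≡ 0
  zeroFree-hasZero y zero-entry with hasZero? y
  ... | yes _       = refl
  ... | no  no-zero = contradiction zero-entry no-zero

  zeroFree-¬hasZero : ∀ {n} (y : Fin n → ℕ) → ¬ HasZero y → zeroFree y ≡ 1
  zeroFree-¬hasZero y no-zero with hasZero? y
  ... | yes zero-entry = contradiction zero-entry no-zero
  ... | no  _          = refl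

  ∏-zeroFree-mod : (y : Fin k → ℕ) → (¬ HasZero y → ¬ Collision y) →
                   ∏ y ≡ zeroFree y * ∏ {k} (λ i → suc (toℕ i)) mod K
  ∏-zeroFree-mod y no-zero⇒no-collision with hasZero? y
  ... | yes (l , yl≡0) = ∣⇒≡0-mod (∣-∏ y l (≡0-mod⇒∣ yl≡0))
  ... | no  no-zero    = ≡-mod-trans (∏-units-mod y no-zero (no-zero⇒no-collision no-zero))
                                     (≡⇒≡-mod (sym (+-identityʳ _)))

  translate : ∀ {n} → (Fin n → ℕ) → ℕ → Fin n → ℕ
  translate V x l = V l + suc (toℕ l) * x

  translate-0 : ∀ {n} (V : Fin n → ℕ) l → translate V 0 l ≡ V l
  translate-0 V l = trans (cong (V l +_) (*-zeroʳ (suc (toℕ l)))) (+-identityʳ (V l))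

  zeros : Fin k → ℕ
  zeros _ = 0

  zeroFree-count : (Fin k → ℕ) → ℕ
  zeroFree-count V = ∑[ σ < K ] zeroFree (translate V (toℕ σ))

  ∑-∏-translate-mod : (V : Fin k → ℕ) →
                      (∀ (σ : Fin K) → ¬ HasZero (translate V (toℕ σ)) → ¬ Collision (translate V (toℕ σ))) →
                      ∑[ σ < K ] ∏ (translate V (toℕ σ)) ≡ zeroFree-count V * ∏ {k} (λ i → suc (toℕ i)) mod K
  ∑-∏-translate-mod V no-zero⇒no-collision = begin
    ∑[ σ < K ] ∏ (translate V (toℕ σ))
      ≈⟨ ∑-cong-mod (λ σ → ∏-zeroFree-mod _ (no-zero⇒no-collision σ)) ⟩
    ∑[ σ < K ] (zeroFree (translate V (toℕ σ)) * ∏ {k} (λ i → suc (toℕ i)))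
      ≡⟨ *-distribʳ-sum {K} _ (λ σ → zeroFree (translate V (toℕ σ))) ⟨
    zeroFree-count V * ∏ {k} (λ i → suc (toℕ i))
      ∎
    where open ≡-mod-Reasoning

  translate-zeros-no-collision : ∀ x → ¬ HasZero (translate zeros x) → ¬ Collision (translate zeros x)
  translate-zeros-no-collision x no-zero (i , j , i≢j , ix≡jx) =
    i≢j (suc-injectiveᶠ (toℕ-injective-mod {suc i} {suc j} (*-cancelʳ-mod x≢0 ix≡jx)))
    where
    x≢0 : ¬ x ≡ 0 mod K
    x≢0 x≡0 = no-zero (i , ∣⇒≡0-mod (∣n⇒∣m*n (suc (toℕ i)) (≡0-mod⇒∣ x≡0)))

  zeroFree-count-zeros : zeroFree-count zeros ≡ k
  zeroFree-count-zeros =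
    cong₂ _+_ (zeroFree-hasZero _ (l₀ , ≡⇒≡-mod (*-zeroʳ (suc (toℕ l₀)))))
              (∑-ones _ (λ σ → zeroFree-¬hasZero _ (λ (l , e) → *-nonzero-mod (suc-nonzero-mod l ≤-refl)
                                                                               (suc-nonzero-mod σ ≤-refl) e)))
    where
    l₀ : Fin k
    l₀ = fromℕ< (s≤s⁻¹ 1<K)

  zeroFree-count-< : (V : Fin k → ℕ) → HasZero V → (∃ λ j → ¬ V j ≡ 0 mod K) → zeroFree-count V < k
  zeroFree-count-< V (i , Vi≡0) (j , Vj≢0) with linear-root (V j) (suc-nonzero-mod j ≤-refl)
  ... | zero  , root = contradiction (≡-mod-trans (≡⇒≡-mod (sym (translate-0 V j))) root) Vj≢0
  ... | suc τ , root =
    subst (λ z → z + sum later < k) (sym (zeroFree-hasZero _ (i , ≡-mod-trans (≡⇒≡-mod (translate-0 V i)) Vi≡0)))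
      (∑-≤1-< later (λ σ → zeroFree-≤1 _) τ (zeroFree-hasZero _ (j , root)))
    where
    later : Fin k → ℕ
    later σ = zeroFree (translate V (toℕ (suc σ)))

  collision-translate : (V : Fin k → ℕ) → HasZero V → (∃ λ j → ¬ V j ≡ 0 mod K) →
                        ∃ λ (σ : Fin K) → ¬ HasZero (translate V (toℕ σ)) × Collision (translate V (toℕ σ))
  collision-translate V zero-entry unit-entry
    with any? (λ σ → ¬? (hasZero? (translate V (toℕ σ))) ×-dec collision? (translate V (toℕ σ)))
  ... | yes found = found
  ... | no  none  = contradiction count≡k (<⇒≢ count<k)
    where
    open ≡-mod-Reasoning
    count<k : zeroFree-count V < k
    count<k = zeroFree-count-< V zero-entry unit-entry
    P : ℕ
    P = ∏ {k} (λ i → suc (toℕ i))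
    count≡k : zeroFree-count V ≡ k
    count≡k = ≡-mod⇒≡ (<-trans count<k (n<1+n k)) (n<1+n k)
      (*-cancelʳ-mod (∏-nonzero-mod _ (λ i → suc-nonzero-mod i ≤-refl)) (begin
        zeroFree-count V * P
          ≈⟨ ∑-∏-translate-mod V (λ σ no-zero collision → none (σ , no-zero , collision)) ⟨
        ∑[ σ < K ] ∏ (translate V (toℕ σ))
          ≈⟨ ∑-∏-affine V (λ l → suc (toℕ l)) ≤-refl ⟩
        ∑[ σ < K ] ∏ (translate zeros (toℕ σ))
          ≈⟨ ∑-∏-translate-mod zeros (translate-zeros-no-collision ∘ toℕ) ⟩
        zeroFree-count zeros * P
          ≡⟨ cong (_* P) zeroFree-count-zeros ⟩
        k * P
          ∎))

  -- −1 is represented by k. If every multiplier μ + 1 sends some entry to −1, then μ ↦ that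
  -- entry is injective, hence onto, and two equal entries receive the same multiplier.
  every-multiplier-hits-−1⇒¬collision : (y : Fin k → ℕ) → ¬ HasZero y →
    (∀ (μ : Fin k) → ∃ λ l → suc (toℕ μ) * y l ≡ k mod K) → ¬ Collision y
  every-multiplier-hits-−1⇒¬collision y no-zero hit (i , j , i≢j , yi≡yj) =
    let μᵢ , gμᵢ≡i = injective⇒surjective g-injective i
        μⱼ , gμⱼ≡j = injective⇒surjective g-injective j
        μᵢ≡μⱼ      = −1-multiplier-unique i (hits-at gμᵢ≡i)
                       (≡-mod-trans (*-congˡ-mod (suc (toℕ μⱼ)) yi≡yj) (hits-at gμⱼ≡j))
    in i≢j (trans (sym gμᵢ≡i) (trans (cong g μᵢ≡μⱼ) gμⱼ≡j))
    where
    g : Fin k → Fin k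
    g μ = proj₁ (hit μ)
    hits-at : ∀ {μ l} → g μ ≡ l → suc (toℕ μ) * y l ≡ k mod K
    hits-at {μ} refl = proj₂ (hit μ)
    −1-multiplier-unique : ∀ l {μ ν} → suc (toℕ μ) * y l ≡ k mod K → suc (toℕ ν) * y l ≡ k mod K → μ ≡ ν
    −1-multiplier-unique l μy≡−1 νy≡−1 = suc-injectiveᶠ (toℕ-injective-mod
      (*-cancelʳ-mod (λ e → no-zero (l , e)) (≡-mod-trans μy≡−1 (≡-mod-sym νy≡−1))))
    g-injective : Injective _≡_ _≡_ g
    g-injective {μ} {ν} gμ≡gν = −1-multiplier-unique (g μ) (hits-at refl) (hits-at (sym gμ≡gν))

  multiplier-avoiding-−1 : (y : Fin k → ℕ) → ¬ HasZero y → Collision y →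
                           ∃ λ (μ : Fin k) → ∀ l → ¬ suc (toℕ μ) * y l ≡ k mod K
  multiplier-avoiding-−1 y no-zero collision =
    let μ , misses = ¬∀⟶∃¬ k _ (λ μ → any? (λ l → ≡-mod? (suc (toℕ μ) * y l) k))
                               (λ hit → every-multiplier-hits-−1⇒¬collision y no-zero hit collision)
    in μ , λ l e → misses (l , e)

  ≢0,−1⇒interior : ∀ {x} → ¬ x ≡ 0 mod K → ¬ x ≡ k mod K → 1 ≤ x % K × x % K ≤ k ∸ 1
  ≢0,−1⇒interior {x} x≢0 x≢k =
    n≢0⇒n>0 (x≢0 ∘ mk≡) , m+n≤o⇒m≤o∸n (x % K) (subst (_≤ k) (sym (+-comm (x % K) 1)) x%K<k)
    where
    x%K<k : x % K < k
    x%K<k = ≤∧≢⇒< (s≤s⁻¹ (m%n<n x K)) (λ e → x≢k (mk≡ (trans e (sym (m<n⇒m%n≡m (n<1+n k))))))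

  interior-combination : (V : Fin k → ℕ) → HasZero V → (∃ λ j → ¬ V j ≡ 0 mod K) →
    Σ (Fin K) λ s → ∃ λ α → ∀ l →
      1 ≤ (toℕ s * V l + suc (toℕ l) * α) % K × (toℕ s * V l + suc (toℕ l) * α) % K ≤ k ∸ 1
  interior-combination V zero-entry unit-entry =
    let σ , no-zero , collision = collision-translate V zero-entry unit-entry
        μ , misses              = multiplier-avoiding-−1 _ no-zero collision
    in suc μ , suc (toℕ μ) * toℕ σ , λ l →
         subst (λ z → 1 ≤ z % K × z % K ≤ k ∸ 1) (sym (regroup (suc (toℕ μ)) (V l) (toℕ σ) (suc (toℕ l))))
               (≢0,−1⇒interior (*-nonzero-mod (suc-nonzero-mod μ ≤-refl) (λ e → no-zero (l , e))) (misses l))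
    where
    regroup : ∀ m v x c → m * v + c * (m * x) ≡ m * (v + c * x)
    regroup = solve-∀
next-multiple : ∀ m k → ∃₂ λ q e → e ≤ k × q * suc k ≡ m + e
next-multiple m k = q , k ∸ r , m∸n≤m k r , (begin
  q * suc k              ≡⟨ m+n∸m≡n r (q * suc k) ⟨
  r + q * suc k ∸ r      ≡⟨ cong (_∸ r) (m≡m%n+[m/n]*n (m + k) (suc k)) ⟨
  m + k ∸ r              ≡⟨ +-∸-assoc m r≤k ⟩
  m + (k ∸ r)            ∎)
  where
  open ≡-Reasoning
  q r : ℕ
  q = (m + k) / suc k
  r = (m + k) % suc k
  r≤k : r ≤ k
  r≤k = s≤s⁻¹ (m%n<n (m + k) (suc k))

quotient-unique : ∀ {a b c e p} .{{_ : NonZero p}} → a < p → c < p → a + b * p ≡ c + e * p → b ≡ e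
quotient-unique {a} {b} {c} {e} {p} a<p c<p eq =
  trans (sym (quotient b a<p)) (trans (cong (_/ p) eq) (quotient e c<p))
  where
  quotient : ∀ {x} y → x < p → (x + y * p) / p ≡ y
  quotient {x} y x<p = trans (+-distrib-/-∣ʳ x (n∣m*n y)) (cong₂ _+_ (m<n⇒m/n≡0 x<p) (m*n/n≡m y p))

scaled-remainder : ∀ {d p R α e} n .{{_ : NonZero d}} .{{_ : NonZero p}} →
                   R * d ≡ α * p + e → n * e < p → d * (n * R % p) / p ≡ n * α mod d
scaled-remainder {d} {p} {R} {α} {e} n Rd≡αp+e ne<p =
  ≡-mod-trans (≡-mod-sym (+-multiple-mod t q)) (≡⇒≡-mod (quotient-unique (m%n<n M p) ne<p key))
  where
  open ≡-Reasoning
  m q M t : ℕ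
  m = n * R
  q = m / p
  M = d * (m % p)
  t = M / p
  key : M % p + (t + q * d) * p ≡ n * e + n * α * p
  key = begin
    M % p + (t + q * d) * p          ≡⟨ regroup (M % p) t q d p ⟩
    M % p + t * p + d * (q * p)      ≡⟨ cong (_+ d * (q * p)) (m≡m%n+[m/n]*n M p) ⟨
    d * (m % p) + d * (q * p)        ≡⟨ *-distribˡ-+ d (m % p) (q * p) ⟨
    d * (m % p + q * p)              ≡⟨ cong (d *_) (m≡m%n+[m/n]*n m p) ⟨
    d * (n * R)                      ≡⟨ swap d n R ⟩
    n * (R * d)                      ≡⟨ cong (n *_) Rd≡αp+e ⟩
    n * (α * p + e)                  ≡⟨ expand n α p e ⟩
    n * e + n * α * p                ∎
    where
    regroup : ∀ a t q d p → a + (t + q * d) * p ≡ a + t * p + d * (q * p)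
    regroup = solve-∀
    swap : ∀ d n R → d * (n * R) ≡ n * (R * d)
    swap = solve-∀
    expand : ∀ n α p e → n * (α * p + e) ≡ n * e + n * α * p
    expand = solve-∀

floor-mkℚ : ∀ q → floor q ≡ ↥ q ℤ./ ↧ q
floor-mkℚ (mkℚ _ _ _) = refl

/-cancel : ∀ (z : ℤ) D g m d .{{_ : NonZero d}} →
           z ℤ.* ℤ.+ g ≡ ℤ.+ m → ℤ.+ suc D ℤ.* ℤ.+ g ≡ ℤ.+ d → z ℤ./ ℤ.+ suc D ≡ ℤ.+ (m / d)
/-cancel z D zero m d _ Dg≡d =
  contradiction (sym (ℤ.+-injective (trans (sym (ℤ.*-zeroʳ (ℤ.+ suc D))) Dg≡d))) (≢-nonZero⁻¹ d)
/-cancel (ℤ.+ a) D (suc g) m d ag≡m Dg≡d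
  with ℤ.+-injective (trans (ℤ.pos-* a (suc g)) ag≡m) | ℤ.+-injective (trans (ℤ.pos-* (suc D) (suc g)) Dg≡d)
... | refl | refl = trans (div-pos-is-/ℕ (ℤ.+ a) (suc D)) (cong ℤ.+_ (sym (m*n/o*n≡m/o a (suc g) (suc D))))
/-cancel -[1+ a ] D (suc g) m d () _

floor-/ : ∀ m d .{{_ : NonZero d}} → floor (ℤ.+ m ℚ./ d) ≡ ℤ.+ (m / d)
floor-/ m d =
  trans (floor-mkℚ q) (/-cancel (↥ q) (ℚ.denominator-1 q) (gcd m d) m d (ℚ.↥-/ (ℤ.+ m) d) (ℚ.↧-/ (ℤ.+ m) d))
  where
  q : ℚ
  q = ℤ.+ m ℚ./ d

toℚᵘ-/ : ∀ i n .{{_ : NonZero n}} → ℚ.toℚᵘ (i ℚ./ n) ≃ i ℚᵘ./ n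
toℚᵘ-/ i (suc n) = ℚ.toℚᵘ-fromℚᵘ (mkℚᵘ i n)

scaled-frac : ∀ a n p .{{_ : NonZero p}} → (ℤ.+ a ℚ./ 1) ℚ.* frac (ℤ.+ n ℚ./ p) ≡ ℤ.+ (a * (n % p)) ℚ./ p
scaled-frac a n p@(suc p′) = ℚ.toℚᵘ-injective (begin
  ℚ.toℚᵘ (A ℚ.* frac X)
    ≈⟨ ℚᵘ.≃-reflexive (cong (λ z → ℚ.toℚᵘ (A ℚ.* (X ℚ.- z ℚ./ 1))) (floor-/ n p)) ⟩
  ℚ.toℚᵘ (A ℚ.* (X ℚ.- Y))
    ≈⟨ ℚ.toℚᵘ-homo-* A (X ℚ.- Y) ⟩
  ℚ.toℚᵘ A ℚᵘ.* ℚ.toℚᵘ (X ℚ.- Y)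
    ≈⟨ ℚᵘ.*-cong (toℚᵘ-/ (ℤ.+ a) 1) toℚᵘ-X-Y ⟩
  (ℤ.+ a ℚᵘ./ 1) ℚᵘ.* ((ℤ.+ n ℚᵘ./ p) ℚᵘ.+ ℚᵘ.- (ℤ.+ q ℚᵘ./ 1))
    ≈⟨ *≡* cross-multiplied ⟩
  (ℤ.+ a ℤ.* ℤ.+ r) ℚᵘ./ p
    ≈⟨ ℚᵘ.≃-reflexive (cong (ℚᵘ._/ p) (ℤ.pos-* a r)) ⟨
  ℤ.+ (a * r) ℚᵘ./ p
    ≈⟨ toℚᵘ-/ (ℤ.+ (a * r)) p ⟨
  ℚ.toℚᵘ (ℤ.+ (a * r) ℚ./ p)
    ∎)
  where
  open ℚᵘ.≃-Reasoning
  q r : ℕ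
  q = n / p
  r = n % p
  A X Y : ℚ
  A = ℤ.+ a ℚ./ 1
  X = ℤ.+ n ℚ./ p
  Y = ℤ.+ q ℚ./ 1
  toℚᵘ-X-Y : ℚ.toℚᵘ (X ℚ.- Y) ≃ (ℤ.+ n ℚᵘ./ p) ℚᵘ.+ ℚᵘ.- (ℤ.+ q ℚᵘ./ 1)
  toℚᵘ-X-Y = begin
    ℚ.toℚᵘ (X ℚ.+ ℚ.- Y)              ≈⟨ ℚ.toℚᵘ-homo-+ X (ℚ.- Y) ⟩
    ℚ.toℚᵘ X ℚᵘ.+ ℚ.toℚᵘ (ℚ.- Y)      ≈⟨ ℚᵘ.+-cong (toℚᵘ-/ (ℤ.+ n) p) (ℚ.toℚᵘ-homo‿- Y) ⟩
    (ℤ.+ n ℚᵘ./ p) ℚᵘ.+ ℚᵘ.- ℚ.toℚᵘ Y  ≈⟨ ℚᵘ.+-congʳ (ℤ.+ n ℚᵘ./ p) (ℚᵘ.-‿cong (toℚᵘ-/ (ℤ.+ q) 1)) ⟩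
    (ℤ.+ n ℚᵘ./ p) ℚᵘ.+ ℚᵘ.- (ℤ.+ q ℚᵘ./ 1) ∎
  n≡r+qp : ℤ.+ n ≡ ℤ.+ r ℤ.+ ℤ.+ q ℤ.* ℤ.+ p
  n≡r+qp = trans (cong ℤ.+_ (m≡m%n+[m/n]*n n p))
                 (trans (ℤ.pos-+ r (q * p)) (cong (λ z → ℤ.+ r ℤ.+ z) (ℤ.pos-* q p)))
  cancel-q : ∀ a r q p → a ℤ.* ((r ℤ.+ q ℤ.* p) ℤ.* ℤ.+ 1 ℤ.+ ℤ.- q ℤ.* p) ℤ.* p ≡ a ℤ.* r ℤ.* p
  cancel-q = ℤ-Solver.solve-∀
  cross-multiplied : ℤ.+ a ℤ.* (ℤ.+ n ℤ.* ℤ.+ 1 ℤ.+ ℤ.- ℤ.+ q ℤ.* ℤ.+ p) ℤ.* ℤ.+ p ≡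
                     ℤ.+ a ℤ.* ℤ.+ r ℤ.* ℤ.+ (1 * (p * 1))
  cross-multiplied =
    trans (cong (λ z → ℤ.+ a ℤ.* (z ℤ.* ℤ.+ 1 ℤ.+ ℤ.- ℤ.+ q ℤ.* ℤ.+ p) ℤ.* ℤ.+ p) n≡r+qp)
      (trans (cancel-q (ℤ.+ a) (ℤ.+ r) (ℤ.+ q) (ℤ.+ p))
        (cong (λ z → ℤ.+ a ℤ.* ℤ.+ r ℤ.* ℤ.+ z) (sym (trans (*-identityˡ (p * 1)) (*-identityʳ p)))))

rk-pos : ∀ k p .{{_ : NonZero p}} R (j : Fin k) → rk k p (ℤ.+ R) j ≡ ℤ.+ (suc k * (suc (toℕ j) * R % p) / p)
rk-pos k p R j = begin
  floor ((ℤ.+ suc k ℚ./ 1) ℚ.* frac ((ℤ.+ suc (toℕ j) ℤ.* ℤ.+ R) ℚ./ p))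
    ≡⟨ cong (λ z → floor ((ℤ.+ suc k ℚ./ 1) ℚ.* frac (z ℚ./ p))) (ℤ.pos-* (suc (toℕ j)) R) ⟨
  floor ((ℤ.+ suc k ℚ./ 1) ℚ.* frac (ℤ.+ (suc (toℕ j) * R) ℚ./ p))
    ≡⟨ cong floor (scaled-frac (suc k) (suc (toℕ j) * R) p) ⟩
  floor (ℤ.+ (suc k * (suc (toℕ j) * R % p)) ℚ./ p)
    ≡⟨ floor-/ (suc k * (suc (toℕ j) * R % p)) p ⟩
  ℤ.+ (suc k * (suc (toℕ j) * R % p) / p)
    ∎
  where open ≡-Reasoning

coord-pos : ∀ k p .{{_ : NonZero p}} s v R (j : Fin k) →
          coord k p s v (ℤ.+ R) j ≡ (toℕ s * toℕ (v j) + suc k * (suc (toℕ j) * R % p) / p) % suc k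
coord-pos k p s v R j = cong (ℤ._%ℕ suc k)
  (trans (cong₂ ℤ._+_ (sym (ℤ.pos-* (toℕ s) (toℕ (v j)))) (rk-pos k p R j)) (sym (ℤ.pos-+ (toℕ s * toℕ (v j)) _)))

coord-progression : ∀ k p .{{_ : NonZero p}} → k * suc k < p → ∀ {α R e} → R * suc k ≡ α * p + e → e ≤ k →
                    ∀ s v (j : Fin k) → coord k p s v (ℤ.+ R) j ≡ (toℕ s * toℕ (v j) + suc (toℕ j) * α) % suc k
coord-progression k p k*K<p {α} {R} {e} RK≡αp+e e≤k s v j =
  trans (coord-pos k p s v R j) (%-≡ (+-cong-mod (≡-mod-refl {a = toℕ s * toℕ (v j)})
    (scaled-remainder {suc k} {p} {R} {α} {e} (suc (toℕ j)) RK≡αp+e je<p)))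
  where
  je<p : suc (toℕ j) * e < p
  je<p = ≤-<-trans (≤-trans (*-mono-≤ (toℕ<n j) e≤k) (*-monoʳ-≤ k (n≤1+n k))) k*K<p

lemma16 : (k p : ℕ) .{{_ : NonZero p}}
    → Prime (suc k) → ¬ (2 ∣ suc k)
    → Prime p → ¬ (2 ∣ p) → k * suc k < p
    → (v : Fin k → Fin (suc k))
    → ¬ IsZeroVec v
    → ∃ (λ (j : Fin k) → toℕ (v j) ≡ 0)
    → Σ (Fin (suc k)) (λ s → Σ ℤ (λ r →
    (j : Fin k) → 1 ≤ coord k p s v r j × coord k p s v r j ≤ k ∸ 1))
lemma16 k p prime-K _ _ _ k*K<p v v≢0 (j₀ , vj₀≡0) =
  let s , α , in-range       = interior-combination prime-K V zero-entry unit-entry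
      R , e , e≤k , RK≡αp+e = next-multiple (α * p) k
  in s , ℤ.+ R , λ j → subst (λ c → 1 ≤ c × c ≤ k ∸ 1)
                             (sym (coord-progression k p k*K<p {α} {R} {e} RK≡αp+e e≤k s v j)) (in-range j)
  where
  V : Fin k → ℕ
  V j = toℕ (v j)
  zero-entry : ∃ λ j → V j ≡ 0 mod suc k
  zero-entry = j₀ , mk≡ (cong (_% suc k) vj₀≡0)
  unit-entry : ∃ λ j → ¬ V j ≡ 0 mod suc k
  unit-entry = let j₁ , vj₁≢0 = ¬∀⟶∃¬ k _ (λ j → V j ≟ 0) v≢0
               in j₁ , <-nonzero-mod (n≢0⇒n>0 vj₁≢0) (toℕ<n (v j₁))
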